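{- For any positive integers $k$ and $b$, there exists a graph $G$ such that $b_t^{k+1}(G)=b_t^k(G)+b$.
   Context: All graphs are finite, simple, undirected, without isolated vertices. A total dominating set of a graph without isolated vertices is a vertex set $S$ such that every vertex is adjacent to some vertex of $S$; $\gamma_t(G)$ is the minimum size of such a set. The $k$-total bondage number $b_t^k(G)$ is the minimum number of edges that must be deleted from $G$ so that the resulting graph (required to have no isolated vertices) has total domination number at least $\gamma_t(G)+k$. -}

module Defs where

open import Data.Nat using (ℕ; suc; _+_; _∸_; _≤_)
open import Data.Bool using (Bool; true; false; T; _∧_; if_then_else_)
open import Data.Fin using (Fin; _<?_)
open import Data.Fin.Subset using (Subset; _∈_; ∣_∣)
open import Data.List using (List; allFin; map)
open import Data.Nat.ListAction using (sum)
open import Data.Product using (∃; ∃-syntax; _×_; _,_)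
open import Relation.Nullary.Decidable using (⌊_⌋)
open import Relation.Binary.PropositionalEquality using (_≡_)

record Graph (n : ℕ) : Set where
  field
    adj    : Fin n → Fin n → Bool
    sym    : ∀ i j → adj i j ≡ adj j i
    irrefl : ∀ i → adj i i ≡ false
open Graph public

Adj : ∀ {n} → Graph n → Fin n → Fin n → Set
Adj G i j = T (adj G i j)

NoIsolated : ∀ {n} → Graph n → Set
NoIsolated {n} G = ∀ (v : Fin n) → ∃[ u ] Adj G v u

edgeCount : ∀ {n} → Graph n → ℕ
edgeCount {n} G =
  sum (map (λ i → sum (map (λ j → if ⌊ i <? j ⌋ ∧ adj G i j then 1 else 0)
                           (allFin n)))
           (allFin n))

_⊆ᴳ_ : ∀ {n} → Graph n → Graph n → Set
_⊆ᴳ_ {n} H G = ∀ (i j : Fin n) → Adj H i j → Adj G i j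

IsTDS : ∀ {n} → Graph n → Subset n → Set
IsTDS {n} G S = ∀ (v : Fin n) → ∃[ u ] (u ∈ S × Adj G v u)

IsTotalDomNum : ∀ {n} → Graph n → ℕ → Set
IsTotalDomNum {n} G t =
  (∃[ S ] (IsTDS G S × ∣ S ∣ ≡ t)) × (∀ (S : Subset n) → IsTDS G S → t ≤ ∣ S ∣)

KRaising : ∀ {n} → Graph n → ℕ → Graph n → Set
KRaising {n} G k H =
  H ⊆ᴳ G × NoIsolated H ×
  ∃[ t ] (IsTotalDomNum G t × (∀ (S : Subset n) → IsTDS H S → t + k ≤ ∣ S ∣))

IsKTotalBondage : ∀ {n} → Graph n → ℕ → ℕ → Set
IsKTotalBondage {n} G k b =
  (∃[ H ] (KRaising G k H × edgeCount G ∸ edgeCount H ≡ b)) ×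
  (∀ (H : Graph n) → KRaising G k H → b ≤ edgeCount G ∸ edgeCount H)

-- Attach a pendant leaf to every vertex of a graph K on m vertices (the corona of K). If H is a spanning
-- subgraph of the corona without isolated vertices, the core together with the leaves of the core vertices
-- isolated in H is a minimum total dominating set of H, so γₜ(H) = m + #(core vertices isolated in H).
-- Hence bₜʲ of the corona is the least number of edges of K whose deletion isolates j of its vertices.
-- Take for K a clique on k + b + 1 vertices and a hub joined to b of them and to k vertices of degree one.
-- Isolating any vertex other than these k costs at least k + b edges, while each of the k costs one edge of
-- its own: so bₜᵏ = k (delete the k short spokes) and bₜᵏ⁺¹ = k + b (delete every edge at the hub).

module Submission where

open import Defs hiding (sym)
open import Data.Nat
  using (ℕ; zero; suc; _+_; _*_; _∸_; _≤_; _<_; _<ᵇ_; _≡ᵇ_; z≤n; s≤s; s≤s⁻¹; z<s; s<s; _<?_; _≟_)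
open import Data.Nat.Properties
open import Data.Bool using (Bool; true; false; T; _∧_; _∨_; not; if_then_else_)
open import Data.Bool.Properties using (T-∧; T-∨; T-≡; ∧-assoc; ∧-comm; ∨-comm)
open import Data.Product using (∃; ∃-syntax; _×_; _,_; proj₁; proj₂)
open import Data.Sum using (_⊎_; inj₁; inj₂; [_,_]′)
open import Function using (_∘_; case_of_; Equivalence)
open import Data.Fin using (Fin; toℕ; fromℕ<) renaming (zero to fzero; suc to fsuc)
open import Data.Fin.Properties using (toℕ<n; toℕ-fromℕ<; fromℕ<-toℕ; toℕ-injective)
open import Data.Fin.Subset using (Subset; _∈_; ∣_∣; _⊆_)
open import Data.Fin.Subset.Properties using (p⊆q⇒∣p∣≤∣q∣)
open import Data.List using (allFin; map; tabulate)
open import Data.List.Properties using (map-tabulate)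
open import Data.Nat.ListAction using (sum)
import Data.Vec as Vec
open import Data.Vec.Properties using (lookup⇒[]=; []=⇒lookup; lookup∘tabulate)
open import Relation.Nullary using (¬_; yes; no; does; contradiction)
open import Relation.Nullary.Decidable using (T?; isYes≗does)
open import Relation.Binary.Definitions using (tri<; tri≈; tri>)
open import Relation.Binary.PropositionalEquality
open import Algebra.Properties.CommutativeSemigroup +-commutativeSemigroup using (interchange)

⟦_⟧ : Bool → ℕ
⟦ p ⟧ = if p then 1 else 0

⟦⟧≤1 : ∀ p → ⟦ p ⟧ ≤ 1
⟦⟧≤1 true  = ≤-refl
⟦⟧≤1 false = z≤n

⟦⟧-true : ∀ {p} → T p → ⟦ p ⟧ ≡ 1
⟦⟧-true {true} _ = refl

⟦⟧-false : ∀ {p} → ¬ T p → ⟦ p ⟧ ≡ 0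
⟦⟧-false {true}  ¬p = contradiction _ ¬p
⟦⟧-false {false} _  = refl

¬T⇒≡false : ∀ {p} → ¬ T p → p ≡ false
¬T⇒≡false {true}  ¬p = contradiction _ ¬p
¬T⇒≡false {false} _  = refl

T-not⁺ : ∀ {p} → ¬ T p → T (not p)
T-not⁺ {true}  ¬p = ¬p _
T-not⁺ {false} _  = _

T-not⁻ : ∀ {p} → T (not p) → ¬ T p
T-not⁻ {false} _ ()

⟦⟧-mono : ∀ {p q} → (T p → T q) → ⟦ p ⟧ ≤ ⟦ q ⟧
⟦⟧-mono {true}  p⇒q = ≤-reflexive (sym (⟦⟧-true (p⇒q _)))
⟦⟧-mono {false} _   = z≤n

⟦∧⟧-T : ∀ {p} q → T p → ⟦ p ∧ q ⟧ ≡ ⟦ q ⟧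
⟦∧⟧-T {true} _ _ = refl

⟦∧⟧-¬T : ∀ {p} q → ¬ T p → ⟦ p ∧ q ⟧ ≡ 0
⟦∧⟧-¬T {true}  _ ¬p = contradiction _ ¬p
⟦∧⟧-¬T {false} _ _  = refl

⟦∨⟧-¬T : ∀ {p} q → ¬ T p → ⟦ p ∨ q ⟧ ≡ ⟦ q ⟧
⟦∨⟧-¬T {true}  _ ¬p = contradiction _ ¬p
⟦∨⟧-¬T {false} _ _  = refl

⟦∨⟧-disjoint : ∀ p q → ¬ (T p × T q) → ⟦ p ∨ q ⟧ ≡ ⟦ p ⟧ + ⟦ q ⟧
⟦∨⟧-disjoint true  true  ¬pq = contradiction _ ¬pq
⟦∨⟧-disjoint true  false _   = refl
⟦∨⟧-disjoint false _     _   = refl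

∑ : ℕ → (ℕ → ℕ) → ℕ
∑ zero    f = 0
∑ (suc n) f = f 0 + ∑ n (f ∘ suc)

syntax ∑ n (λ i → e) = ∑[ i < n ] e

∑-cong : ∀ n {f g : ℕ → ℕ} → (∀ i → i < n → f i ≡ g i) → ∑ n f ≡ ∑ n g
∑-cong zero    _  = refl
∑-cong (suc n) eq = cong₂ _+_ (eq 0 z<s) (∑-cong n (λ i i<n → eq (suc i) (s<s i<n)))

∑-mono-≤ : ∀ n {f g : ℕ → ℕ} → (∀ i → i < n → f i ≤ g i) → ∑ n f ≤ ∑ n g
∑-mono-≤ zero    _  = z≤n
∑-mono-≤ (suc n) le = +-mono-≤ (le 0 z<s) (∑-mono-≤ n (λ i i<n → le (suc i) (s<s i<n)))

∑-zero : ∀ n {f : ℕ → ℕ} → (∀ i → i < n → f i ≡ 0) → ∑ n f ≡ 0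
∑-zero zero    _  = refl
∑-zero (suc n) eq = cong₂ _+_ (eq 0 z<s) (∑-zero n (λ i i<n → eq (suc i) (s<s i<n)))

∑-distrib-+ : ∀ n (f g : ℕ → ℕ) → ∑[ i < n ] (f i + g i) ≡ ∑ n f + ∑ n g
∑-distrib-+ zero    f g = refl
∑-distrib-+ (suc n) f g =
  trans (cong (f 0 + g 0 +_) (∑-distrib-+ n (f ∘ suc) (g ∘ suc)))
        (interchange (f 0) (g 0) (∑ n (f ∘ suc)) (∑ n (g ∘ suc)))

∑-split : ∀ m n (f : ℕ → ℕ) → ∑ (m + n) f ≡ ∑ m f + ∑[ i < n ] f (m + i)
∑-split zero    n f = refl
∑-split (suc m) n f =
  trans (cong (f 0 +_) (∑-split m n (f ∘ suc))) (sym (+-assoc (f 0) _ _))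

∑-prefix-≤ : ∀ m n (f : ℕ → ℕ) → ∑ m f ≤ ∑ (m + n) f
∑-prefix-≤ m n f = subst (∑ m f ≤_) (sym (∑-split m n f)) (m≤m+n _ _)

≡ᵇ-refl : ∀ v → T (v ≡ᵇ v)
≡ᵇ-refl v = ≡⇒≡ᵇ v v refl

≡ᵇ-sym : ∀ x y → (x ≡ᵇ y) ≡ (y ≡ᵇ x)
≡ᵇ-sym zero    zero    = refl
≡ᵇ-sym zero    (suc y) = refl
≡ᵇ-sym (suc x) zero    = refl
≡ᵇ-sym (suc x) (suc y) = ≡ᵇ-sym x y

∑-single : ∀ n {v} c → v < n → ∑[ i < n ] (⟦ i ≡ᵇ v ⟧ * c) ≡ c
∑-single (suc n) {zero}  c _ =
  trans (cong (c + 0 +_) (∑-zero n (λ _ _ → refl))) (trans (+-identityʳ _) (+-identityʳ c))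
∑-single (suc n) {suc v} c (s<s v<n) = ∑-single n c v<n

∑-≤-except : ∀ n {f g : ℕ → ℕ} {v} → v < n → (∀ i → i < n → i ≢ v → f i ≤ g i) →
             ∑ n f ≤ ∑ n g + f v
∑-≤-except n {f} {g} {v} v<n le = begin
  ∑ n f                                       ≤⟨ ∑-mono-≤ n pointwise ⟩
  ∑[ i < n ] (g i + ⟦ i ≡ᵇ v ⟧ * f v)         ≡⟨ ∑-distrib-+ n g _ ⟩
  ∑ n g + ∑[ i < n ] (⟦ i ≡ᵇ v ⟧ * f v)       ≡⟨ cong (∑ n g +_) (∑-single n (f v) v<n) ⟩
  ∑ n g + f v                                 ∎
  where
  open ≤-Reasoning
  pointwise : ∀ i → i < n → f i ≤ g i + ⟦ i ≡ᵇ v ⟧ * f v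
  pointwise i i<n with i ≟ v
  ... | yes refl rewrite ⟦⟧-true (≡ᵇ-refl i) | *-identityˡ (f i) = m≤n+m (f i) (g i)
  ... | no  i≢v  = ≤-trans (le i i<n i≢v) (m≤m+n (g i) _)

∑-term : ∀ n (f : ℕ → ℕ) {i} → i < n → f i ≤ ∑ n f
∑-term (suc n) f {zero}  _         = m≤m+n (f 0) _
∑-term (suc n) f {suc i} (s<s i<n) = ≤-trans (∑-term n (f ∘ suc) i<n) (m≤n+m _ (f 0))

∑-column+row : ∀ n {v} (f : ℕ → ℕ → ℕ) → v < n →
               ∑[ x < n ] (f x v + ⟦ x ≡ᵇ v ⟧ * ∑[ y < n ] f v y) ≡ ∑[ x < n ] f x v + ∑[ y < n ] f v y
∑-column+row n {v} f v<n =
  trans (∑-distrib-+ n (λ x → f x v) _) (cong (∑[ x < n ] f x v +_) (∑-single n _ v<n))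

∑∑-≥-cross : ∀ n {v} (f : ℕ → ℕ → ℕ) → v < n → f v v ≡ 0 →
             ∑[ x < n ] f x v + ∑[ y < n ] f v y ≤ ∑[ x < n ] ∑[ y < n ] f x y
∑∑-≥-cross n {v} f v<n fvv =
  subst (_≤ ∑[ x < n ] ∑[ y < n ] f x y) (∑-column+row n f v<n) (∑-mono-≤ n pointwise)
  where
  pointwise : ∀ x → x < n → f x v + ⟦ x ≡ᵇ v ⟧ * ∑[ y < n ] f v y ≤ ∑[ y < n ] f x y
  pointwise x _ with x ≟ v
  ... | yes refl rewrite fvv | ⟦⟧-true (≡ᵇ-refl x) = ≤-reflexive (+-identityʳ _)
  ... | no  x≢v  rewrite ⟦⟧-false (x≢v ∘ ≡ᵇ⇒≡ x v) =
    ≤-trans (≤-reflexive (+-identityʳ (f x v))) (∑-term n (f x) v<n)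

∑∑-≤-cross : ∀ n {v} (f : ℕ → ℕ → ℕ) → v < n →
             (∀ x y → x < n → y < n → x ≢ v → y ≢ v → f x y ≡ 0) →
             ∑[ x < n ] ∑[ y < n ] f x y ≤ ∑[ x < n ] f x v + ∑[ y < n ] f v y
∑∑-≤-cross n {v} f v<n off-cross =
  subst (∑[ x < n ] ∑[ y < n ] f x y ≤_) (∑-column+row n f v<n) (∑-mono-≤ n pointwise)
  where
  pointwise : ∀ x → x < n → ∑[ y < n ] f x y ≤ f x v + ⟦ x ≡ᵇ v ⟧ * ∑[ y < n ] f v y
  pointwise x x<n with x ≟ v
  ... | yes refl rewrite ⟦⟧-true (≡ᵇ-refl x) | +-identityʳ (∑[ y < n ] f x y) = m≤n+m _ (f x x)
  ... | no  x≢v  = begin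
    ∑[ y < n ] f x y               ≤⟨ ∑-≤-except n v<n (λ y y<n y≢v →
                                        ≤-reflexive (off-cross x y x<n y<n x≢v y≢v)) ⟩
    ∑[ _ < n ] 0 + f x v           ≡⟨ cong (_+ f x v) (∑-zero n (λ _ _ → refl)) ⟩
    f x v                          ≤⟨ m≤m+n (f x v) _ ⟩
    f x v + ⟦ x ≡ᵇ v ⟧ * ∑[ y < n ] f v y ∎
    where open ≤-Reasoning

count : ℕ → (ℕ → Bool) → ℕ
count n p = ∑[ i < n ] ⟦ p i ⟧

count-mono : ∀ n {p q : ℕ → Bool} → (∀ i → i < n → T (p i) → T (q i)) → count n p ≤ count n q
count-mono n p⇒q = ∑-mono-≤ n (λ i i<n → ⟦⟧-mono (p⇒q i i<n))

count-all : ∀ n → count n (λ _ → true) ≡ n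
count-all zero    = refl
count-all (suc n) = cong suc (count-all n)

count-below : ∀ {c n} → c ≤ n → count n (_<ᵇ c) ≡ c
count-below {zero}  {n}     _         = ∑-zero n (λ _ _ → refl)
count-below {suc c} {suc n} (s≤s c≤n) = cong suc (count-below c≤n)

count-above : ∀ a r → count (suc a + r) (a <ᵇ_) ≡ r
count-above zero    r = count-all r
count-above (suc a) r = count-above a r

count-restrict : ∀ {m n} (p : ℕ → Bool) → m ≤ n → count n (λ i → (i <ᵇ m) ∧ p i) ≡ count m p
count-restrict {zero}  {n}     p _         = ∑-zero n (λ _ _ → refl)
count-restrict {suc m} {suc n} p (s≤s m≤n) = cong (⟦ p 0 ⟧ +_) (count-restrict (p ∘ suc) m≤n)

count-∨ : ∀ n (p q : ℕ → Bool) → (∀ i → ¬ (T (p i) × T (q i))) →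
          count n (λ i → p i ∨ q i) ≡ count n p + count n q
count-∨ n p q disjoint =
  trans (∑-cong n (λ i _ → ⟦∨⟧-disjoint (p i) (q i) (disjoint i))) (∑-distrib-+ n _ _)

edges : ℕ → (ℕ → ℕ → Bool) → ℕ
edges n E = ∑[ x < n ] count n (λ y → (x <ᵇ y) ∧ E x y)

degree : ℕ → (ℕ → ℕ → Bool) → ℕ → ℕ
degree n E v = count n (E v)

module _ {E : ℕ → ℕ → Bool} (E-sym : ∀ x y → E x y ≡ E y x) where

  private
    ordered : ℕ → ℕ → ℕ
    ordered x y = ⟦ (x <ᵇ y) ∧ E x y ⟧

  degree≡column+row : ∀ n {v} → ¬ T (E v v) →
                      degree n E v ≡ ∑[ x < n ] ordered x v + ∑[ y < n ] ordered v y
  degree≡column+row n {v} ¬Evv = trans (∑-cong n (λ u _ → split u)) (∑-distrib-+ n _ _)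
    where
    split : ∀ u → ⟦ E v u ⟧ ≡ ordered u v + ordered v u
    split u with <-cmp u v
    ... | tri< u<v _ _ = begin
      ⟦ E v u ⟧              ≡⟨ cong ⟦_⟧ (E-sym v u) ⟩
      ⟦ E u v ⟧              ≡⟨ sym (⟦∧⟧-T _ (<⇒<ᵇ u<v)) ⟩
      ordered u v            ≡⟨ sym (+-identityʳ _) ⟩
      ordered u v + 0        ≡⟨ cong (ordered u v +_) (sym (⟦∧⟧-¬T _ (<-asym u<v ∘ <ᵇ⇒< v u))) ⟩
      ordered u v + ordered v u ∎
      where open ≡-Reasoning
    ... | tri≈ _ refl _ = begin
      ⟦ E u u ⟧              ≡⟨ ⟦⟧-false ¬Evv ⟩
      0                      ≡⟨ sym (cong₂ _+_ u↛u u↛u) ⟩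
      ordered u u + ordered u u ∎
      where
      open ≡-Reasoning
      u↛u : ordered u u ≡ 0
      u↛u = ⟦∧⟧-¬T _ (<-irrefl refl ∘ <ᵇ⇒< u u)
    ... | tri> _ _ v<u = begin
      ⟦ E v u ⟧              ≡⟨ sym (⟦∧⟧-T _ (<⇒<ᵇ v<u)) ⟩
      ordered v u            ≡⟨ cong (_+ ordered v u) (sym (⟦∧⟧-¬T _ (<-asym v<u ∘ <ᵇ⇒< u v))) ⟩
      ordered u v + ordered v u ∎
      where open ≡-Reasoning

  degree≤edges : ∀ n {v} → v < n → ¬ T (E v v) → degree n E v ≤ edges n E
  degree≤edges n {v} v<n ¬Evv =
    subst (_≤ edges n E) (sym (degree≡column+row n ¬Evv))
          (∑∑-≥-cross n ordered v<n (⟦∧⟧-¬T _ (<-irrefl refl ∘ <ᵇ⇒< v v)))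

  edges≤degree : ∀ n {v} → v < n → ¬ T (E v v) →
                 (∀ x y → x < n → y < n → T (E x y) → x ≡ v ⊎ y ≡ v) → edges n E ≤ degree n E v
  edges≤degree n {v} v<n ¬Evv star =
    subst (edges n E ≤_) (sym (degree≡column+row n ¬Evv)) (∑∑-≤-cross n ordered v<n off-star)
    where
    off-star : ∀ x y → x < n → y < n → x ≢ v → y ≢ v → ordered x y ≡ 0
    off-star x y x<n y<n x≢v y≢v = ⟦⟧-false λ t →
      [ x≢v , y≢v ]′ (star x y x<n y<n (proj₂ (Equivalence.to T-∧ t)))

adjℕ : ∀ {n} → Graph n → ℕ → ℕ → Bool
adjℕ {n} G x y with x <? n | y <? n
... | yes x<n | yes y<n = adj G (fromℕ< x<n) (fromℕ< y<n)
... | _       | _       = false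

adjℕ-toℕ : ∀ {n} (G : Graph n) (i j : Fin n) → adjℕ G (toℕ i) (toℕ j) ≡ adj G i j
adjℕ-toℕ {n} G i j with toℕ i <? n | toℕ j <? n
... | yes i<n | yes j<n = cong₂ (adj G) (fromℕ<-toℕ i i<n) (fromℕ<-toℕ j j<n)
... | yes _   | no j≮n  = contradiction (toℕ<n j) j≮n
... | no i≮n  | _       = contradiction (toℕ<n i) i≮n

Adj⇒adjℕ : ∀ {n} (G : Graph n) {i j} → Adj G i j → T (adjℕ G (toℕ i) (toℕ j))
Adj⇒adjℕ G {i} {j} = subst T (sym (adjℕ-toℕ G i j))

adjℕ⇒Adj : ∀ {n} (G : Graph n) {i j} → T (adjℕ G (toℕ i) (toℕ j)) → Adj G i j
adjℕ⇒Adj G {i} {j} = subst T (adjℕ-toℕ G i j)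

adjℕ-fromℕ< : ∀ {n x y} (G : Graph n) (x<n : x < n) (y<n : y < n) →
              adjℕ G x y ≡ adj G (fromℕ< x<n) (fromℕ< y<n)
adjℕ-fromℕ< G x<n y<n =
  trans (sym (cong₂ (adjℕ G) (toℕ-fromℕ< x<n) (toℕ-fromℕ< y<n))) (adjℕ-toℕ G _ _)

adjℕ-sym : ∀ {n} (G : Graph n) x y → adjℕ G x y ≡ adjℕ G y x
adjℕ-sym {n} G x y with x <? n | y <? n
... | yes _ | yes _ = Graph.sym G _ _
... | yes _ | no  _ = refl
... | no  _ | yes _ = refl
... | no  _ | no  _ = refl

adjℕ-irrefl : ∀ {n} (G : Graph n) x → ¬ T (adjℕ G x x)
adjℕ-irrefl {n} G x with x <? n
... | yes _ = subst T (irrefl G _)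
... | no  _ = λ ()

adjℕ-mono : ∀ {n} {H G : Graph n} → H ⊆ᴳ G → ∀ x y → T (adjℕ H x y) → T (adjℕ G x y)
adjℕ-mono {n} H⊆G x y with x <? n | y <? n
... | yes _ | yes _ = H⊆G _ _
... | yes _ | no  _ = λ ()
... | no  _ | _     = λ ()

sum-allFin : ∀ n (g : Fin n → ℕ) (f : ℕ → ℕ) → (∀ i → g i ≡ f (toℕ i)) → sum (map g (allFin n)) ≡ ∑ n f
sum-allFin n g f g≡f = trans (cong sum (map-tabulate (λ i → i) g)) (sum-tabulate n g f g≡f)
  where
  sum-tabulate : ∀ n (g : Fin n → ℕ) (f : ℕ → ℕ) → (∀ i → g i ≡ f (toℕ i)) → sum (tabulate g) ≡ ∑ n f
  sum-tabulate zero    g f _   = refl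
  sum-tabulate (suc n) g f g≡f =
    cong₂ _+_ (g≡f fzero) (sum-tabulate n (g ∘ fsuc) (f ∘ suc) (g≡f ∘ fsuc))

edgeCount≡edges : ∀ {n} (G : Graph n) → edgeCount G ≡ edges n (adjℕ G)
edgeCount≡edges {n} G = sum-allFin n _ _ λ i → sum-allFin n _ _ λ j →
  cong₂ (λ a e → if a ∧ e then 1 else 0) (isYes≗does (i Data.Fin.<? j)) (sym (adjℕ-toℕ G i j))

removedEdge : ∀ {n} → Graph n → Graph n → ℕ → ℕ → Bool
removedEdge G H x y = adjℕ G x y ∧ not (adjℕ H x y)

removedEdge-sym : ∀ {n} (G H : Graph n) x y → removedEdge G H x y ≡ removedEdge G H y x
removedEdge-sym G H x y = cong₂ (λ g h → g ∧ not h) (adjℕ-sym G x y) (adjℕ-sym H x y)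

removedEdge-irrefl : ∀ {n} (G H : Graph n) x → ¬ T (removedEdge G H x x)
removedEdge-irrefl G H x = adjℕ-irrefl G x ∘ proj₁ ∘ Equivalence.to T-∧

deletionCount : ∀ {n} → Graph n → Graph n → ℕ
deletionCount G H = edgeCount G ∸ edgeCount H

deletionCount≡edges : ∀ {n} {H G : Graph n} → H ⊆ᴳ G → deletionCount G H ≡ edges n (removedEdge G H)
deletionCount≡edges {n} {H} {G} H⊆G = begin
  edgeCount G ∸ edgeCount H                                       ≡⟨ cong₂ _∸_ (edgeCount≡edges G)
                                                                                 (edgeCount≡edges H) ⟩
  edges n (adjℕ G) ∸ edges n (adjℕ H)                           ≡⟨ cong (_∸ edges n (adjℕ H)) kept+removed ⟩
  edges n (adjℕ H) + edges n (removedEdge G H) ∸ edges n (adjℕ H) ≡⟨ m+n∸m≡n (edges n (adjℕ H)) _ ⟩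
  edges n (removedEdge G H)                                     ∎
  where
  open ≡-Reasoning
  split : ∀ a g h → (T h → T g) → ⟦ a ∧ g ⟧ ≡ ⟦ a ∧ h ⟧ + ⟦ a ∧ (g ∧ not h) ⟧
  split false _     _     _   = refl
  split true  true  true  _   = refl
  split true  true  false _   = refl
  split true  false true  h⇒g = contradiction (h⇒g _) λ ()
  split true  false false _   = refl
  kept+removed : edges n (adjℕ G) ≡ edges n (adjℕ H) + edges n (removedEdge G H)
  kept+removed =
    trans (∑-cong n λ x _ →
             trans (∑-cong n λ y _ → split (x <ᵇ y) (adjℕ G x y) (adjℕ H x y) (adjℕ-mono H⊆G x y))
                   (∑-distrib-+ n _ _))
          (∑-distrib-+ n _ _)

∣tabulate∣ : ∀ n (p : ℕ → Bool) → ∣ Vec.tabulate {n = n} (p ∘ toℕ) ∣ ≡ count n p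
∣tabulate∣ zero    p = refl
∣tabulate∣ (suc n) p with p 0
... | true  = cong suc (∣tabulate∣ n (p ∘ suc))
... | false = ∣tabulate∣ n (p ∘ suc)

∈-tabulate⁺ : ∀ {n} (p : ℕ → Bool) {i : Fin n} → T (p (toℕ i)) → i ∈ Vec.tabulate (p ∘ toℕ)
∈-tabulate⁺ p {i} t = lookup⇒[]= i _ (trans (lookup∘tabulate _ i) (Equivalence.to T-≡ t))

∈-tabulate⁻ : ∀ {n} (p : ℕ → Bool) {i : Fin n} → i ∈ Vec.tabulate (p ∘ toℕ) → T (p (toℕ i))
∈-tabulate⁻ p {i} i∈ = Equivalence.from T-≡ (trans (sym (lookup∘tabulate _ i)) ([]=⇒lookup i∈))

totalDom-unique : ∀ {n} {G : Graph n} {s t} → IsTotalDomNum G s → IsTotalDomNum G t → s ≡ t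
totalDom-unique ((S , S-tds , ∣S∣≡s) , s-min) ((S′ , S′-tds , ∣S′∣≡t) , t-min) =
  ≤-antisym (subst (_ ≤_) ∣S′∣≡t (s-min S′ S′-tds)) (subst (_ ≤_) ∣S∣≡s (t-min S S-tds))

isKTotalBondage-intro : ∀ {n} {G H : Graph n} {j c} → KRaising G j H → deletionCount G H ≤ c →
                        (∀ H′ → KRaising G j H′ → c ≤ deletionCount G H′) → IsKTotalBondage G j c
isKTotalBondage-intro {H = H} raising H≤c minimal =
  (H , raising , ≤-antisym H≤c (minimal H raising)) , minimal

record SimpleGraphℕ : Set where
  field
    edge        : ℕ → ℕ → Bool
    edge-sym    : ∀ x y → edge x y ≡ edge y x
    edge-irrefl : ∀ x → ¬ T (edge x x)
open SimpleGraphℕ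

module Corona (m : ℕ) (K : SimpleGraphℕ) where

  n : ℕ
  n = m + m

  -- Vertices x < m carry K; vertex x + m is a pendant leaf attached to x.
  adjᶜ : ℕ → ℕ → Bool
  adjᶜ x y with x <? m | y <? m
  ... | yes _ | yes _ = edge K x y
  ... | yes _ | no  _ = y ≡ᵇ x + m
  ... | no  _ | yes _ = x ≡ᵇ y + m
  ... | no  _ | no  _ = false

  adjᶜ-sym : ∀ x y → adjᶜ x y ≡ adjᶜ y x
  adjᶜ-sym x y with x <? m | y <? m
  ... | yes _ | yes _ = edge-sym K x y
  ... | yes _ | no  _ = refl
  ... | no  _ | yes _ = refl
  ... | no  _ | no  _ = refl

  adjᶜ-irrefl : ∀ x → adjᶜ x x ≡ false
  adjᶜ-irrefl x with x <? m
  ... | yes _ = ¬T⇒≡false (edge-irrefl K x)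
  ... | no  _ = refl

  corona : Graph n
  corona = record
    { adj    = λ i j → adjᶜ (toℕ i) (toℕ j)
    ; sym    = λ i j → adjᶜ-sym (toℕ i) (toℕ j)
    ; irrefl = λ i → adjᶜ-irrefl (toℕ i)
    }

  adjᶜ-core : ∀ {x y} → x < m → y < m → adjᶜ x y ≡ edge K x y
  adjᶜ-core {x} {y} x<m y<m with x <? m | y <? m
  ... | yes _ | yes _   = refl
  ... | yes _ | no y≮m  = contradiction y<m y≮m
  ... | no x≮m | _      = contradiction x<m x≮m

  adjᶜ-leaf : ∀ {x y} → m ≤ x → T (adjᶜ x y) → x ≡ y + m
  adjᶜ-leaf {x} {y} m≤x a with x <? m | y <? m
  ... | yes x<m | _     = contradiction m≤x (<⇒≱ x<m)
  ... | no _    | yes _ = ≡ᵇ⇒≡ x (y + m) a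
  ... | no _    | no _  = contradiction a λ ()

  adjᶜ-pendant : ∀ {x} → x < m → T (adjᶜ (x + m) x)
  adjᶜ-pendant {x} x<m with (x + m) <? m | x <? m
  ... | yes x+m<m | _      = contradiction x+m<m (≤⇒≯ (m≤n+m m x))
  ... | no _      | yes _  = ≡ᵇ-refl (x + m)
  ... | no _      | no x≮m = contradiction x<m x≮m

  adjℕ-corona : ∀ {x y} → x < n → y < n → adjℕ corona x y ≡ adjᶜ x y
  adjℕ-corona x<n y<n = trans (adjℕ-fromℕ< corona x<n y<n) (cong₂ adjᶜ (toℕ-fromℕ< x<n) (toℕ-fromℕ< y<n))

  adjℕ-corona-core : ∀ {x y} → x < m → y < m → adjℕ corona x y ≡ edge K x y
  adjℕ-corona-core x<m y<m =
    trans (adjℕ-corona (<-≤-trans x<m (m≤m+n m m)) (<-≤-trans y<m (m≤m+n m m))) (adjᶜ-core x<m y<m)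

  coreVertex : ∀ {x} → x < m → Fin n
  coreVertex x<m = fromℕ< (<-≤-trans x<m (m≤m+n m m))

  leafVertex : ∀ {x} → x < m → Fin n
  leafVertex x<m = fromℕ< (+-monoˡ-< m x<m)

  data Kind (i : Fin n) : Set where
    core : toℕ i < m → Kind i
    leaf : ∀ {x} → x < m → toℕ i ≡ x + m → Kind i

  kind : (i : Fin n) → Kind i
  kind i with toℕ i <? m
  ... | yes i<m = core i<m
  ... | no  i≮m = leaf x<m (sym (m∸n+n≡m m≤i))
    where
    m≤i : m ≤ toℕ i
    m≤i = ≮⇒≥ i≮m
    x<m : toℕ i ∸ m < m
    x<m = +-cancelʳ-< m _ m (subst (_< n) (sym (m∸n+n≡m m≤i)) (toℕ<n i))

  isolatedInCore : Graph n → ℕ → Bool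
  isolatedInCore H x = not (does (anyUpTo? (λ u → T? (adjℕ H x u)) m))

  isolatedCount : Graph n → ℕ
  isolatedCount H = count m (isolatedInCore H)

  isolated-or-neighbour : ∀ H x → T (isolatedInCore H x) ⊎ ∃[ u ] (u < m × T (adjℕ H x u))
  isolated-or-neighbour H x with anyUpTo? (λ u → T? (adjℕ H x u)) m
  ... | yes neighbour = inj₂ neighbour
  ... | no  _         = inj₁ _

  isolated⇒no-neighbour : ∀ {H x u} → T (isolatedInCore H x) → u < m → ¬ T (adjℕ H x u)
  isolated⇒no-neighbour {H} {x} {u} iso u<m a with anyUpTo? (λ u → T? (adjℕ H x u)) m
  ... | no ∄neighbour = ∄neighbour (u , u<m , a)

  no-neighbour⇒isolated : ∀ {H x} → (∀ u → u < m → ¬ T (adjℕ H x u)) → T (isolatedInCore H x)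
  no-neighbour⇒isolated {H} {x} ∄neighbour with anyUpTo? (λ u → T? (adjℕ H x u)) m
  ... | yes (u , u<m , a) = ∄neighbour u u<m a
  ... | no  _             = _

  coreOrLeafOf : (ℕ → Bool) → ℕ → Bool
  coreOrLeafOf A x = (x <ᵇ m) ∨ A (x ∸ m)

  core∪leavesOf : (ℕ → Bool) → Subset n
  core∪leavesOf A = Vec.tabulate (coreOrLeafOf A ∘ toℕ)

  ∣core∪leavesOf∣ : ∀ A → ∣ core∪leavesOf A ∣ ≡ m + count m A
  ∣core∪leavesOf∣ A = begin
    ∣ core∪leavesOf A ∣                                              ≡⟨ ∣tabulate∣ n (coreOrLeafOf A) ⟩
    count (m + m) (coreOrLeafOf A)                                   ≡⟨ ∑-split m m _ ⟩
    count m (coreOrLeafOf A) + ∑[ i < m ] ⟦ coreOrLeafOf A (m + i) ⟧ ≡⟨ cong₂ _+_ core-part leaf-part ⟩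
    m + count m A                                                    ∎
    where
    open ≡-Reasoning
    core-part : count m (coreOrLeafOf A) ≡ m
    core-part = trans (∑-cong m (λ x x<m → ⟦⟧-true (Equivalence.from T-∨ (inj₁ (<⇒<ᵇ x<m))))) (count-all m)
    leaf-part : ∑[ i < m ] ⟦ coreOrLeafOf A (m + i) ⟧ ≡ count m A
    leaf-part = ∑-cong m λ i _ →
      trans (⟦∨⟧-¬T _ (≤⇒≯ (m≤m+n m i) ∘ <ᵇ⇒< (m + i) m)) (cong (⟦_⟧ ∘ A) (m+n∸m≡n m i))

  core∈core∪leavesOf : ∀ A {i} → toℕ i < m → i ∈ core∪leavesOf A
  core∈core∪leavesOf A i<m = ∈-tabulate⁺ (coreOrLeafOf A) (Equivalence.from T-∨ (inj₁ (<⇒<ᵇ i<m)))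

  leaf∈core∪leavesOf : ∀ A {i x} → toℕ i ≡ x + m → T (A x) → i ∈ core∪leavesOf A
  leaf∈core∪leavesOf A {i} {x} i≡x+m Ax =
    ∈-tabulate⁺ (coreOrLeafOf A) (Equivalence.from T-∨ (inj₂ (subst (T ∘ A) (sym x≡i∸m) Ax)))
    where
    x≡i∸m : toℕ i ∸ m ≡ x
    x≡i∸m = trans (cong (_∸ m) i≡x+m) (m+n∸n≡m x m)

  core∪leavesOf-leaf : ∀ A {i x} → toℕ i ≡ x + m → i ∈ core∪leavesOf A → T (A x)
  core∪leavesOf-leaf A {i} {x} i≡x+m i∈ with Equivalence.to T-∨ (∈-tabulate⁻ (coreOrLeafOf A) i∈)
  ... | inj₁ i<m = contradiction (<ᵇ⇒< (toℕ i) m i<m) (≤⇒≯ (subst (m ≤_) (sym i≡x+m) (m≤n+m m x)))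
  ... | inj₂ Ai∸m = subst (T ∘ A) (trans (cong (_∸ m) i≡x+m) (m+n∸n≡m x m)) Ai∸m

  module _ {H : Graph n} (H⊆corona : H ⊆ᴳ corona) where

    leaf-neighbour : ∀ {i j x} → toℕ i ≡ x + m → Adj H i j → toℕ j ≡ x
    leaf-neighbour {i} {j} {x} i≡x+m a =
      +-cancelʳ-≡ m _ _ (trans (sym (adjᶜ-leaf m≤i (H⊆corona i j a))) i≡x+m)
      where
      m≤i : m ≤ toℕ i
      m≤i = subst (m ≤_) (sym i≡x+m) (m≤n+m m x)

    attached-leaf : ∀ {i j} → m ≤ toℕ j → Adj H i j → toℕ j ≡ toℕ i + m
    attached-leaf {i} {j} m≤j a =
      adjᶜ-leaf m≤j (subst T (adjᶜ-sym (toℕ i) (toℕ j)) (H⊆corona i j a))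

    core∪isolatedLeaves⊆tds : ∀ {S} → IsTDS H S → core∪leavesOf (isolatedInCore H) ⊆ S
    core∪isolatedLeaves⊆tds {S} tds {i} i∈ with kind i
    ... | core i<m with tds (leafVertex i<m)
    ...   | u , u∈S , ℓ~u = subst (_∈ S) (toℕ-injective (leaf-neighbour (toℕ-fromℕ< _) ℓ~u)) u∈S
    core∪isolatedLeaves⊆tds {S} tds {i} i∈ | leaf x<m i≡x+m with tds (coreVertex x<m)
    ... | u , u∈S , c~u with toℕ u <? m
    ...   | yes u<m = contradiction (subst (λ z → T (adjℕ H z (toℕ u))) (toℕ-fromℕ< _) (Adj⇒adjℕ H c~u))
                                    (isolated⇒no-neighbour (core∪leavesOf-leaf (isolatedInCore H) i≡x+m i∈) u<m)
    ...   | no  u≮m = subst (_∈ S) (toℕ-injective u≡i) u∈S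
      where
      u≡i : toℕ u ≡ toℕ i
      u≡i = trans (attached-leaf (≮⇒≥ u≮m) c~u) (trans (cong (_+ m) (toℕ-fromℕ< _)) (sym i≡x+m))

    core∪isolatedLeaves-isTDS : NoIsolated H → IsTDS H (core∪leavesOf (isolatedInCore H))
    core∪isolatedLeaves-isTDS noIso v with kind v
    ... | leaf x<m v≡x+m with noIso v
    ...   | w , v~w =
      w , core∈core∪leavesOf (isolatedInCore H) (subst (_< m) (sym (leaf-neighbour v≡x+m v~w)) x<m) , v~w
    core∪isolatedLeaves-isTDS noIso v | core v<m with isolated-or-neighbour H (toℕ v)
    ... | inj₂ (u , u<m , a) =
      coreVertex u<m ,
      core∈core∪leavesOf (isolatedInCore H) (subst (_< m) (sym (toℕ-fromℕ< _)) u<m) ,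
      adjℕ⇒Adj H (subst (T ∘ adjℕ H (toℕ v)) (sym (toℕ-fromℕ< _)) a)
    ... | inj₁ iso with noIso (leafVertex v<m)
    ...   | w , ℓ~w = leafVertex v<m , leaf∈core∪leavesOf (isolatedInCore H) (toℕ-fromℕ< _) iso , v~ℓ
      where
      -- the leaf of v is not isolated in H, and its only possible neighbour is v
      w≡v : w ≡ v
      w≡v = toℕ-injective (leaf-neighbour (toℕ-fromℕ< _) ℓ~w)
      v~ℓ : Adj H v (leafVertex v<m)
      v~ℓ = subst (λ z → Adj H z (leafVertex v<m)) w≡v (subst T (Graph.sym H _ w) ℓ~w)

    totalDom-spanning : NoIsolated H → IsTotalDomNum H (m + isolatedCount H)
    totalDom-spanning noIso =
      (core∪leavesOf (isolatedInCore H) , core∪isolatedLeaves-isTDS noIso , ∣core∪leavesOf∣ _) ,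
      λ S tds → subst (_≤ ∣ S ∣) (∣core∪leavesOf∣ _) (p⊆q⇒∣p∣≤∣q∣ (core∪isolatedLeaves⊆tds tds))

    isolated-edge-removed : ∀ {x y} → x < m → y < m → T (edge K x y) →
                            T (isolatedInCore H x) ⊎ T (isolatedInCore H y) → T (removedEdge corona H x y)
    isolated-edge-removed {x} {y} x<m y<m e iso =
      Equivalence.from T-∧ (in-corona , T-not⁺ not-in-H)
      where
      in-corona : T (adjℕ corona x y)
      in-corona = subst T (sym (adjℕ-corona-core x<m y<m)) e
      not-in-H : ¬ T (adjℕ H x y)
      not-in-H = [ (λ iso-x → isolated⇒no-neighbour iso-x y<m) ,
                   (λ iso-y → isolated⇒no-neighbour iso-y x<m ∘ subst T (adjℕ-sym H x y)) ]′ iso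

    count≤deletionCount : ∀ {v} (p : ℕ → Bool) → v < m →
                          (∀ u → u < m → T (p u) → T (removedEdge corona H v u)) →
                          count m p ≤ deletionCount corona H
    count≤deletionCount {v} p v<m p⇒removed = begin
      count m p                          ≤⟨ count-mono m p⇒removed ⟩
      count m (removedEdge corona H v)   ≤⟨ ∑-prefix-≤ m m _ ⟩
      degree n (removedEdge corona H) v  ≤⟨ degree≤edges (removedEdge-sym corona H) n (<-≤-trans v<m (m≤m+n m m))
                                                         (removedEdge-irrefl corona H v) ⟩
      edges n (removedEdge corona H)     ≡⟨ sym (deletionCount≡edges H⊆corona) ⟩
      deletionCount corona H             ∎
      where open ≤-Reasoning

  corona-noIsolated : NoIsolated corona
  corona-noIsolated v with kind v
  ... | core v<m = leafVertex v<m ,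
    subst (λ z → T (adjᶜ (toℕ v) z)) (sym (toℕ-fromℕ< _)) (subst T (adjᶜ-sym _ _) (adjᶜ-pendant v<m))
  ... | leaf x<m v≡x+m = coreVertex x<m ,
    subst₂ (λ a c → T (adjᶜ a c)) (sym v≡x+m) (sym (toℕ-fromℕ< _)) (adjᶜ-pendant x<m)

  CoreTotal : Set
  CoreTotal = ∀ x → x < m → ∃[ y ] (y < m × T (edge K x y))

  isolatedCount-corona : CoreTotal → isolatedCount corona ≡ 0
  isolatedCount-corona total = ∑-zero m λ x x<m → ⟦⟧-false λ iso →
    let (y , y<m , e) = total x x<m in
    isolated⇒no-neighbour iso y<m (subst T (sym (adjℕ-corona-core x<m y<m)) e)

  isolated-in-corona : ∀ {x} → x < m → (∀ y → y < m → ¬ T (edge K x y)) → T (isolatedInCore corona x)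
  isolated-in-corona x<m ∄edge =
    no-neighbour⇒isolated λ y y<m a → ∄edge y y<m (subst T (adjℕ-corona-core x<m y<m) a)

  totalDom-corona : CoreTotal → IsTotalDomNum corona m
  totalDom-corona total =
    subst (IsTotalDomNum corona) (trans (cong (m +_) (isolatedCount-corona total)) (+-identityʳ m))
          (totalDom-spanning (λ _ _ a → a) corona-noIsolated)

  raising⇒isolatedCount : CoreTotal → ∀ {j H} → KRaising corona j H → j ≤ isolatedCount H
  raising⇒isolatedCount total {j} {H} (H⊆corona , noIso , t , γₜ≡t , raised) =
    +-cancelˡ-≤ m j _ (subst₂ _≤_ (cong (_+ j) t≡m) (∣core∪leavesOf∣ (isolatedInCore H))
                               (raised _ (core∪isolatedLeaves-isTDS H⊆corona noIso)))
    where
    t≡m : t ≡ m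
    t≡m = totalDom-unique {G = corona} γₜ≡t (totalDom-corona total)

  isolatedCount⇒raising : CoreTotal → ∀ {j H} → H ⊆ᴳ corona → NoIsolated H → j ≤ isolatedCount H →
                          KRaising corona j H
  isolatedCount⇒raising total {j} {H} H⊆corona noIso j≤I =
    H⊆corona , noIso , m , totalDom-corona total ,
    λ S tds → ≤-trans (+-monoʳ-≤ m j≤I) (proj₂ (totalDom-spanning {H} H⊆corona noIso) S tds)

module _ {m : ℕ} {K K′ : SimpleGraphℕ} (K′⊆K : ∀ x y → T (edge K′ x y) → T (edge K x y)) where
  private
    module C  = Corona m K
    module C′ = Corona m K′
    n : ℕ
    n = m + m

  corona-⊆ : C′.corona ⊆ᴳ C.corona
  corona-⊆ i j with toℕ i <? m | toℕ j <? m
  ... | yes _ | yes _ = K′⊆K _ _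
  ... | yes _ | no  _ = λ a → a
  ... | no  _ | yes _ = λ a → a
  ... | no  _ | no  _ = λ a → a

  removedEdge-corona : ∀ {x y} → x < n → y < n → T (removedEdge C.corona C′.corona x y) →
                       x < m × y < m × T (edge K x y) × ¬ T (edge K′ x y)
  removedEdge-corona {x} {y} x<n y<n r with Equivalence.to T-∧ r
  ... | in-G , not-in-H =
    core-edge (subst T (C.adjℕ-corona x<n y<n) in-G) (T-not⁻ not-in-H ∘ subst T (sym (C′.adjℕ-corona x<n y<n)))
    where
    core-edge : T (C.adjᶜ x y) → ¬ T (C′.adjᶜ x y) → x < m × y < m × T (edge K x y) × ¬ T (edge K′ x y)
    core-edge with x <? m | y <? m
    ... | yes x<m | yes y<m = λ e ¬e′ → x<m , y<m , e , ¬e′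
    ... | yes _   | no  _   = λ e ¬e′ → contradiction e ¬e′
    ... | no  _   | yes _   = λ e ¬e′ → contradiction e ¬e′
    ... | no  _   | no  _   = λ ()

  deletionCount-corona-star : ∀ {v} → v < m →
    (∀ x y → x < m → y < m → T (edge K x y) → ¬ T (edge K′ x y) → x ≡ v ⊎ y ≡ v) →
    deletionCount C.corona C′.corona ≤ count m (λ u → edge K v u ∧ not (edge K′ v u))
  deletionCount-corona-star {v} v<m star = begin
    deletionCount C.corona C′.corona      ≡⟨ deletionCount≡edges corona-⊆ ⟩
    edges n D                             ≤⟨ edges≤degree (removedEdge-sym C.corona C′.corona) n v<n
                                                          (removedEdge-irrefl C.corona C′.corona v) star′ ⟩
    degree n D v                          ≤⟨ count-mono n removed⇒core ⟩
    count n (λ u → (u <ᵇ m) ∧ (edge K v u ∧ not (edge K′ v u))) ≡⟨ count-restrict _ (m≤m+n m m) ⟩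
    count m (λ u → edge K v u ∧ not (edge K′ v u)) ∎
    where
    open ≤-Reasoning
    D : ℕ → ℕ → Bool
    D = removedEdge C.corona C′.corona
    v<n : v < n
    v<n = <-≤-trans v<m (m≤m+n m m)
    star′ : ∀ x y → x < n → y < n → T (D x y) → x ≡ v ⊎ y ≡ v
    star′ x y x<n y<n r with removedEdge-corona x<n y<n r
    ... | x<m , y<m , e , ¬e′ = star x y x<m y<m e ¬e′
    removed⇒core : ∀ u → u < n → T (D v u) → T ((u <ᵇ m) ∧ (edge K v u ∧ not (edge K′ v u)))
    removed⇒core u u<n r with removedEdge-corona v<n u<n r
    ... | _ , u<m , e , ¬e′ = Equivalence.from T-∧ (<⇒<ᵇ u<m , Equivalence.from T-∧ (e , T-not⁺ ¬e′))

module Construction (k b : ℕ) (1≤b : 1 ≤ b) where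

  -- Core vertices: a clique on [0, N), a hub N and k more vertices N + 1, …, N + k;
  -- coreEdge s joins the hub to the vertices in s.
  N : ℕ
  N = suc (k + b)

  m : ℕ
  m = suc N + k

  N<m : N < m
  N<m = s≤s (m≤m+n N k)

  b<N : b < N
  b<N = s≤s (m≤n+m b k)

  clique : ℕ → ℕ → Bool
  clique x y = (x <ᵇ N) ∧ (y <ᵇ N) ∧ not (x ≡ᵇ y)

  hubEdge : (ℕ → Bool) → ℕ → ℕ → Bool
  hubEdge s x y = (x ≡ᵇ N) ∧ s y

  coreEdge : (ℕ → Bool) → ℕ → ℕ → Bool
  coreEdge s x y = clique x y ∨ hubEdge s x y ∨ hubEdge s y x

  clique-sym : ∀ x y → clique x y ≡ clique y x
  clique-sym x y = begin
    (x <ᵇ N) ∧ (y <ᵇ N) ∧ not (x ≡ᵇ y)   ≡⟨ sym (∧-assoc (x <ᵇ N) _ _) ⟩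
    ((x <ᵇ N) ∧ (y <ᵇ N)) ∧ not (x ≡ᵇ y) ≡⟨ cong₂ _∧_ (∧-comm (x <ᵇ N) _) (cong not (≡ᵇ-sym x y)) ⟩
    ((y <ᵇ N) ∧ (x <ᵇ N)) ∧ not (y ≡ᵇ x) ≡⟨ ∧-assoc (y <ᵇ N) _ _ ⟩
    (y <ᵇ N) ∧ (x <ᵇ N) ∧ not (y ≡ᵇ x)   ∎
    where open ≡-Reasoning

  coreEdge-sym : ∀ s x y → coreEdge s x y ≡ coreEdge s y x
  coreEdge-sym s x y = cong₂ _∨_ (clique-sym x y) (∨-comm (hubEdge s x y) _)

  coreEdge-cases : ∀ {s x y} → T (coreEdge s x y) →
                   (x < N × y < N × x ≢ y) ⊎ (x ≡ N × T (s y)) ⊎ (y ≡ N × T (s x))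
  coreEdge-cases {s} {x} {y} e with Equivalence.to T-∨ e
  ... | inj₁ c with Equivalence.to T-∧ c
  ...   | x<N , c′ with Equivalence.to T-∧ c′
  ...     | y<N , x≢y = inj₁ (<ᵇ⇒< x N x<N , <ᵇ⇒< y N y<N , T-not⁻ x≢y ∘ ≡⇒≡ᵇ x y)
  coreEdge-cases {s} {x} {y} e | inj₂ h with Equivalence.to T-∨ h
  ... | inj₁ hx = let (x≡N , sy) = Equivalence.to T-∧ hx in inj₂ (inj₁ (≡ᵇ⇒≡ x N x≡N , sy))
  ... | inj₂ hy = let (y≡N , sx) = Equivalence.to T-∧ hy in inj₂ (inj₂ (≡ᵇ⇒≡ y N y≡N , sx))

  coreEdge-clique : ∀ s {x y} → x < N → y < N → x ≢ y → T (coreEdge s x y)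
  coreEdge-clique s {x} {y} x<N y<N x≢y =
    Equivalence.from (T-∨ {clique x y}) (inj₁ (Equivalence.from (T-∧ {x <ᵇ N})
      (<⇒<ᵇ x<N , Equivalence.from (T-∧ {y <ᵇ N}) (<⇒<ᵇ y<N , T-not⁺ (x≢y ∘ ≡ᵇ⇒≡ x y)))))

  coreEdge-hub : ∀ s y → T (s y) → T (coreEdge s N y)
  coreEdge-hub s y sy =
    Equivalence.from (T-∨ {clique N y}) (inj₂ (Equivalence.from (T-∨ {hubEdge s N y})
      (inj₁ (Equivalence.from (T-∧ {N ≡ᵇ N}) (≡ᵇ-refl N , sy)))))

  core : (s : ℕ → Bool) → ¬ T (s N) → SimpleGraphℕ
  core s ¬sN = record
    { edge        = coreEdge s
    ; edge-sym    = coreEdge-sym s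
    ; edge-irrefl = λ x e → case coreEdge-cases {s} {x} {x} e of λ where
        (inj₁ (_ , _ , x≢x))     → x≢x refl
        (inj₂ (inj₁ (x≡N , sx))) → ¬sN (subst (T ∘ s) x≡N sx)
        (inj₂ (inj₂ (x≡N , sx))) → ¬sN (subst (T ∘ s) x≡N sx)
    }

  coreEdge-mono : ∀ s s′ → (∀ u → T (s′ u) → T (s u)) → ∀ x y → T (coreEdge s′ x y) → T (coreEdge s x y)
  coreEdge-mono s s′ s′⊆s x y e with coreEdge-cases {s′} {x} {y} e
  ... | inj₁ (x<N , y<N , x≢y)   = coreEdge-clique s x<N y<N x≢y
  ... | inj₂ (inj₁ (refl , s′y)) = coreEdge-hub s y (s′⊆s y s′y)
  ... | inj₂ (inj₂ (refl , s′x)) = subst T (coreEdge-sym s N x) (coreEdge-hub s x (s′⊆s x s′x))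

  coreEdge-star : ∀ s s′ x y → T (coreEdge s x y) → ¬ T (coreEdge s′ x y) → x ≡ N ⊎ y ≡ N
  coreEdge-star s s′ x y e ¬e′ with coreEdge-cases {s} {x} {y} e
  ... | inj₁ (x<N , y<N , x≢y) = contradiction (coreEdge-clique s′ x<N y<N x≢y) ¬e′
  ... | inj₂ (inj₁ (x≡N , _))  = inj₁ x≡N
  ... | inj₂ (inj₂ (y≡N , _))  = inj₂ y≡N

  spokes : ℕ → Bool
  spokes u = (u <ᵇ b) ∨ (N <ᵇ u)

  longSpokes : ℕ → Bool
  longSpokes u = u <ᵇ b

  noSpokes : ℕ → Bool
  noSpokes _ = false

  ¬spokes-N : ¬ T (spokes N)
  ¬spokes-N t = case Equivalence.to (T-∨ {N <ᵇ b}) t of λ where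
    (inj₁ N<b) → <-asym b<N (<ᵇ⇒< N b N<b)
    (inj₂ N<N) → <-irrefl refl (<ᵇ⇒< N N N<N)

  ¬longSpokes-N : ¬ T (longSpokes N)
  ¬longSpokes-N = <-asym b<N ∘ <ᵇ⇒< N b

  long⊆spokes : ∀ u → T (longSpokes u) → T (spokes u)
  long⊆spokes u = Equivalence.from (T-∨ {u <ᵇ b}) ∘ inj₁

  spokes-above : ∀ {u} → N < u → T (spokes u)
  spokes-above {u} N<u = Equivalence.from (T-∨ {u <ᵇ b}) (inj₂ (<⇒<ᵇ N<u))

  K K₁ K₂ : SimpleGraphℕ
  K  = core spokes ¬spokes-N
  K₁ = core longSpokes ¬longSpokes-N
  K₂ = core noSpokes λ ()

  module G  = Corona m K
  module H₁ = Corona m K₁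
  module H₂ = Corona m K₂

  core-total : G.CoreTotal
  core-total x x<m with <-cmp x N
  ... | tri< x<N _ _  = clique-neighbour x x<N
    where
    1<N : 1 < N
    1<N = s≤s (≤-trans 1≤b (m≤n+m b k))
    clique-neighbour : ∀ x → x < N → ∃[ y ] (y < m × T (coreEdge spokes x y))
    clique-neighbour zero    _   = 1 , <-trans 1<N N<m , coreEdge-clique spokes z<s 1<N (λ ())
    clique-neighbour (suc x) x<N = 0 , z<s , coreEdge-clique spokes x<N z<s (λ ())
  ... | tri≈ _ refl _ = 0 , z<s , coreEdge-hub spokes 0 (Equivalence.from (T-∨ {0 <ᵇ b}) (inj₁ (<⇒<ᵇ 1≤b)))
  ... | tri> _ _ N<x  = N , N<m , subst T (coreEdge-sym spokes N x) (coreEdge-hub spokes x (spokes-above N<x))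

  count-spokes : count m spokes ≡ b + k
  count-spokes = begin
    count m spokes                    ≡⟨ count-∨ m _ _ (λ u (u<b , N<u) →
                                           <-asym (<-trans (<ᵇ⇒< u b u<b) b<N) (<ᵇ⇒< N u N<u)) ⟩
    count m (_<ᵇ b) + count m (N <ᵇ_) ≡⟨ cong₂ _+_ (count-below (<⇒≤ (<-trans b<N N<m))) (count-above N k) ⟩
    b + k                             ∎
    where open ≡-Reasoning

  heavy-degree : ∀ {v} → v ≤ N → k + b ≤ count m (coreEdge spokes v)
  heavy-degree {v} v≤N with m≤n⇒m<n∨m≡n v≤N
  ... | inj₁ v<N = s≤s⁻¹ (begin
    N                                            ≡⟨ count-below (<⇒≤ N<m) ⟨
    count m (_<ᵇ N)                              ≤⟨ ∑-≤-except m (<-trans v<N N<m) clique-neighbours ⟩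
    count m (coreEdge spokes v) + ⟦ v <ᵇ N ⟧     ≤⟨ +-monoʳ-≤ _ (⟦⟧≤1 (v <ᵇ N)) ⟩
    count m (coreEdge spokes v) + 1              ≡⟨ +-comm _ 1 ⟩
    suc (count m (coreEdge spokes v))            ∎)
    where
    open ≤-Reasoning
    clique-neighbours : ∀ u → u < m → u ≢ v → ⟦ u <ᵇ N ⟧ ≤ ⟦ coreEdge spokes v u ⟧
    clique-neighbours u _ u≢v = ⟦⟧-mono λ u<N → coreEdge-clique spokes v<N (<ᵇ⇒< u N u<N) (u≢v ∘ sym)
  ... | inj₂ refl = begin
    k + b                       ≡⟨ trans count-spokes (+-comm b k) ⟨
    count m spokes              ≤⟨ count-mono m (λ u _ → coreEdge-hub spokes u) ⟩
    count m (coreEdge spokes N) ∎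
    where open ≤-Reasoning

  -- An isolated vertex ≤ N has lost its ≥ k + b edges; otherwise only vertices above the hub are isolated,
  -- and each of them has lost its edge to the hub.
  cost-dichotomy : ∀ {H} → H ⊆ᴳ G.corona →
                   k + b ≤ deletionCount G.corona H ⊎
                   (G.isolatedCount H ≤ k × G.isolatedCount H ≤ deletionCount G.corona H)
  cost-dichotomy {H} H⊆G with anyUpTo? (λ v → T? (G.isolatedInCore H v)) (suc N)
  ... | yes (v , s≤s v≤N , iso) =
    inj₁ (≤-trans (heavy-degree v≤N)
                  (G.count≤deletionCount H⊆G _ v<m λ u u<m e →
                     G.isolated-edge-removed H⊆G v<m u<m e (inj₁ iso)))
    where
    v<m : v < m
    v<m = ≤-<-trans v≤N N<m
  ... | no none = inj₂ (isolated≤k , isolated≤cost)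
    where
    above-hub : ∀ u → T (G.isolatedInCore H u) → N < u
    above-hub u iso = ≰⇒> λ u≤N → none (u , s≤s u≤N , iso)
    isolated≤k : G.isolatedCount H ≤ k
    isolated≤k = ≤-trans (count-mono m λ u _ iso → <⇒<ᵇ (above-hub u iso)) (≤-reflexive (count-above N k))
    isolated≤cost : G.isolatedCount H ≤ deletionCount G.corona H
    isolated≤cost = G.count≤deletionCount H⊆G _ N<m λ u u<m iso →
      G.isolated-edge-removed H⊆G N<m u<m (coreEdge-hub spokes u (spokes-above (above-hub u iso))) (inj₂ iso)

  deletionCount-spokes : ∀ s′ (¬s′N : ¬ T (s′ N)) → (∀ u → T (s′ u) → T (spokes u)) →
                         deletionCount G.corona (Corona.corona m (core s′ ¬s′N)) ≤
                         count m (λ u → spokes u ∧ not (s′ u))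
  deletionCount-spokes s′ ¬s′N s′⊆s =
    ≤-trans (deletionCount-corona-star {m} {K} {core s′ ¬s′N} (coreEdge-mono spokes s′ s′⊆s) N<m
                                       (λ x y _ _ → coreEdge-star spokes s′ x y))
            (count-mono m hub-edge)
    where
    hub-edge : ∀ u → u < m → T (coreEdge spokes N u ∧ not (coreEdge s′ N u)) → T (spokes u ∧ not (s′ u))
    hub-edge u _ t with Equivalence.to T-∧ t
    ... | e , ¬e′ with coreEdge-cases {spokes} {N} {u} e
    ...   | inj₁ (N<N , _)       = contradiction N<N (<-irrefl refl)
    ...   | inj₂ (inj₁ (_ , su)) = Equivalence.from T-∧ (su , T-not⁺ (T-not⁻ ¬e′ ∘ coreEdge-hub s′ u))
    ...   | inj₂ (inj₂ (_ , sN)) = contradiction sN ¬spokes-N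

  deletionCount-H₁ : deletionCount G.corona H₁.corona ≤ k
  deletionCount-H₁ = begin
    deletionCount G.corona H₁.corona              ≤⟨ deletionCount-spokes longSpokes ¬longSpokes-N long⊆spokes ⟩
    count m (λ u → spokes u ∧ not (longSpokes u)) ≤⟨ count-mono m short ⟩
    count m (N <ᵇ_)                               ≡⟨ count-above N k ⟩
    k                                             ∎
    where
    open ≤-Reasoning
    short : ∀ u → u < m → T (spokes u ∧ not (u <ᵇ b)) → T (N <ᵇ u)
    short u _ t with Equivalence.to T-∧ t
    ... | su , ¬long with Equivalence.to (T-∨ {u <ᵇ b}) su
    ...   | inj₁ long = contradiction long (T-not⁻ ¬long)
    ...   | inj₂ N<u  = N<u

  deletionCount-H₂ : deletionCount G.corona H₂.corona ≤ k + b
  deletionCount-H₂ = begin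
    deletionCount G.corona H₂.corona            ≤⟨ deletionCount-spokes noSpokes (λ ()) (λ _ ()) ⟩
    count m (λ u → spokes u ∧ not (noSpokes u)) ≤⟨ count-mono m (λ u _ →
                                                     proj₁ ∘ Equivalence.to (T-∧ {spokes u} {true})) ⟩
    count m spokes                              ≡⟨ trans count-spokes (+-comm b k) ⟩
    k + b                                       ∎
    where open ≤-Reasoning

  isolatedCount-H₁ : k ≤ G.isolatedCount H₁.corona
  isolatedCount-H₁ = begin
    k                                 ≡⟨ count-above N k ⟨
    count m (N <ᵇ_)                   ≤⟨ count-mono m (λ u u<m N<u →
                                           H₁.isolated-in-corona u<m λ _ _ → no-edge (<ᵇ⇒< N u N<u)) ⟩
    G.isolatedCount H₁.corona         ∎
    where
    open ≤-Reasoning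
    no-edge : ∀ {u w} → N < u → ¬ T (coreEdge longSpokes u w)
    no-edge {u} {w} N<u e with coreEdge-cases {longSpokes} {u} {w} e
    ... | inj₁ (u<N , _)         = <-asym u<N N<u
    ... | inj₂ (inj₁ (refl , _)) = <-irrefl refl N<u
    ... | inj₂ (inj₂ (_ , u<b))  = <-asym (<-trans (<ᵇ⇒< u b u<b) b<N) N<u

  isolatedCount-H₂ : suc k ≤ G.isolatedCount H₂.corona
  isolatedCount-H₂ = begin
    suc k                             ≡⟨ hub-and-above ⟨
    count m (k + b <ᵇ_)               ≤⟨ count-mono m (λ u u<m N≤u →
                                           H₂.isolated-in-corona u<m λ _ _ → no-edge (<ᵇ⇒< (k + b) u N≤u)) ⟩
    G.isolatedCount H₂.corona         ∎
    where
    open ≤-Reasoning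
    hub-and-above : count m (k + b <ᵇ_) ≡ suc k
    hub-and-above = subst (λ z → count z (k + b <ᵇ_) ≡ suc k) (+-suc N k) (count-above (k + b) (suc k))
    no-edge : ∀ {u w} → N ≤ u → ¬ T (coreEdge noSpokes u w)
    no-edge {u} {w} N≤u e with coreEdge-cases {noSpokes} {u} {w} e
    ... | inj₁ (u<N , _)       = <-irrefl refl (<-≤-trans u<N N≤u)
    ... | inj₂ (inj₁ (_ , ()))
    ... | inj₂ (inj₂ (_ , ()))

  raising-H₁ : KRaising G.corona k H₁.corona
  raising-H₁ = G.isolatedCount⇒raising core-total
                 (corona-⊆ {m} {K} {K₁} (coreEdge-mono spokes longSpokes long⊆spokes))
                 H₁.corona-noIsolated isolatedCount-H₁

  raising-H₂ : KRaising G.corona (suc k) H₂.corona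
  raising-H₂ = G.isolatedCount⇒raising core-total
                 (corona-⊆ {m} {K} {K₂} (coreEdge-mono spokes noSpokes λ _ ()))
                 H₂.corona-noIsolated isolatedCount-H₂

  k≤deletionCount : ∀ {H} → KRaising G.corona k H → k ≤ deletionCount G.corona H
  k≤deletionCount {H} raising@(H⊆G , _) with cost-dichotomy {H} H⊆G
  ... | inj₁ heavy         = ≤-trans (m≤m+n k b) heavy
  ... | inj₂ (_ , I≤cost)  = ≤-trans (G.raising⇒isolatedCount core-total raising) I≤cost

  k+b≤deletionCount : ∀ {H} → KRaising G.corona (suc k) H → k + b ≤ deletionCount G.corona H
  k+b≤deletionCount {H} raising@(H⊆G , _) with cost-dichotomy {H} H⊆G
  ... | inj₁ heavy     = heavy
  ... | inj₂ (I≤k , _) = contradiction (≤-trans (G.raising⇒isolatedCount core-total raising) I≤k) 1+n≰n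

  bondage-k : IsKTotalBondage G.corona k k
  bondage-k = isKTotalBondage-intro {G = G.corona} {H = H₁.corona}
                raising-H₁ deletionCount-H₁ λ H → k≤deletionCount {H}

  bondage-suc-k : IsKTotalBondage G.corona (suc k) (k + b)
  bondage-suc-k = isKTotalBondage-intro {G = G.corona} {H = H₂.corona}
                    raising-H₂ deletionCount-H₂ λ H → k+b≤deletionCount {H}

corollary4p2 : ∀ (k b : ℕ) → 1 ≤ k → 1 ≤ b →
    ∃[ n ] ∃[ G ] (NoIsolated {n} G × ∃[ c ] (IsKTotalBondage G k c × IsKTotalBondage G (suc k) (c + b)))
corollary4p2 k b _ 1≤b = _ , G.corona , G.corona-noIsolated , k , bondage-k , bondage-suc-k
  where open Construction k b 1≤b
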